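{- Let $n,a,b$ be integers with $n\ge 3$ and $b\le a<2\frac{n+1}{n}b$, and let $c=\lfloor c(n,a,b)\rfloor$. Let $P_{n+1}$ be the path with vertices $x_1,x_2,\dots,x_{n+1}$ in order. Then for every list assignment $L$ of $P_{n+1}$ with $|L(x_1)|=|L(x_{n+1})|=b$, $|L(x_i)|=a$ for $2\le i\le n$, and $|L(x_i)\cap L(x_{i+1})|\le c$ for $1\le i\le n$, there exists an $(L,b)$-coloring of $P_{n+1}$.
   Context: A list assignment $L$ of a graph assigns to each vertex $v$ a finite set $L(v)$ of integers (colors). An $(L,b)$-coloring is a function $\varphi$ assigning to each vertex $v$ a set $\varphi(v)\subseteq L(v)$ with $|\varphi(v)|=b$ such that $\varphi(u)\cap\varphi(v)=\emptyset$ for every edge $uv$. For integers $n$ and $b\le a$ define \[c(n,a,b)=\begin{cases}\frac{n-1}{n}(a-b), & b\le a<\frac{2n-1}{n-1}b,\\ \frac{n-1}{n-2}(a-b)-\frac{2}{n-2}b, & \frac{2n-1}{n-1}b\le a<2\frac{n+1}{n}b,\\ a, & 2\frac{n+1}{n}b\le a.\end{cases}\] -}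

module Defs where

open import Data.Nat as ℕ using (ℕ; zero; suc)
open import Data.Integer as ℤ using (ℤ; +_)
open import Data.Rational as ℚ using (ℚ; 0ℚ; _/_; floor)
open import Data.Rational.Properties using (_<?_; _≤?_)
open import Data.Fin using (Fin; zero; suc; inject₁; fromℕ)
open import Data.List using (List; length; filter)
open import Data.List.Relation.Unary.Unique.Propositional using (Unique)
open import Data.List.Membership.Propositional using (_∈_; _∉_)
open import Data.List.Membership.DecPropositional ℤ._≟_ using (_∈?_)
open import Data.Product using (_×_)
open import Relation.Nullary using (yes; no)
open import Relation.Binary.PropositionalEquality using (_≡_; _≢_)

⟦_⟧ : ℤ → ℚ
⟦ z ⟧ = z / 1

-- the rational p/d, for a natural denominator d (d = 0 never occurs in use; value 0 then)
frac : ℤ → ℕ → ℚ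
frac p zero    = 0ℚ
frac p (suc d) = p / suc d

cfun : ℕ → ℤ → ℤ → ℚ
cfun n a b with ⟦ a ⟧ <? frac (+ (2 ℕ.* n ℕ.∸ 1)) (n ℕ.∸ 1) ℚ.* ⟦ b ⟧
... | yes _ = frac (+ (n ℕ.∸ 1)) n ℚ.* ⟦ a ℤ.- b ⟧
... | no _ with ⟦ a ⟧ <? frac (+ (2 ℕ.* (n ℕ.+ 1))) n ℚ.* ⟦ b ⟧
...   | yes _ = frac (+ (n ℕ.∸ 1)) (n ℕ.∸ 2) ℚ.* ⟦ a ℤ.- b ⟧
                ℚ.- frac (+ 2) (n ℕ.∸ 2) ℚ.* ⟦ b ⟧
...   | no _  = ⟦ a ⟧

-- a finite set of integer colours: a duplicate-free list
-- |A ∩ B| for duplicate-free lists A, B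
∣_∩_∣ : List ℤ → List ℤ → ℕ
∣ A ∩ B ∣ = length (filter (_∈? B) A)

-- the path P_{n+1}: vertices Fin (suc n) (vertex x_{k+1} is index k),
-- edges {inject₁ i , suc i} for i : Fin n.
ListAssignment : ℕ → Set
ListAssignment n = Fin (suc n) → List ℤ

record Coloring (n : ℕ) (L : ListAssignment n) (b : ℤ) : Set where
  field
    φ        : Fin (suc n) → List ℤ
    φ-set    : ∀ v → Unique (φ v)
    φ-size   : ∀ v → + length (φ v) ≡ b
    φ-sub    : ∀ v x → x ∈ φ v → x ∈ L v
    φ-proper : ∀ (i : Fin n) x → x ∈ φ (inject₁ i) → x ∉ φ (suc i)

{-# OPTIONS --safe #-}

-- Colour the path greedily from x₁ to x_{n+1}: at each vertex take b of the colours not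
-- used at the previous vertex, preferring those missing from the next list.  With
-- d = (a - b) - c, the overlap bound c keeps b colours free at every interior vertex, and
-- the number t_j of chosen colours lying in the next list drops by d per step:
-- t_j ≤ min(b,c) - j d.  At x_n at least b free colours avoid L(x_{n+1}) as soon as
-- min(b,c) - (n-2) d + min(b,c) ≤ a - b, so x_{n+1} keeps all of its b colours.  Both
-- branches of c(n,a,b) below 2(n+1)b/n yield this inequality together with c ≤ a - b.

module Submission where

open import Defs
open import Data.Nat as ℕ using (ℕ; zero; suc; _+_; _*_; _∸_; _⊓_; _≤_; _<_; z≤n; s≤s)
open import Data.Nat.Properties
open import Data.Nat.Tactic.RingSolver using (solve-∀)
open import Data.Integer as ℤ using (ℤ; +_; -[1+_]; +≤+)
import Data.Integer.Properties as ℤP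
open import Data.Integer.DivMod using ([n/d]*d≤n)
import Data.Integer.Tactic.RingSolver as ℤRing
open import Data.Rational as ℚ using (ℚ; mkℚ; floor; toℚᵘ)
open import Data.Rational.Properties as ℚP using (toℚᵘ-fromℚᵘ; toℚᵘ-homo-*; toℚᵘ-homo-+; toℚᵘ-homo‿-; toℚᵘ-mono-<)
open import Data.Rational.Unnormalised as ℚᵘ using (mkℚᵘ; *≤*; *≡*)
import Data.Rational.Unnormalised.Properties as ℚᵘP
open import Data.Fin using (Fin; zero; suc; inject₁; fromℕ; fromℕ<; toℕ)
open import Data.Fin.Properties as Fin using (toℕ≤pred[n]; toℕ-inject₁)
open import Data.List using (List; []; _∷_; length; filter; take; _++_)
open import Data.List.Properties using (length-filter; length-take; length-++; filter-notAll)
open import Data.List.Relation.Unary.All as All using (All; _∷_)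
open import Data.List.Relation.Unary.All.Properties using (all-filter)
open import Data.List.Relation.Unary.Any as Any using (here; there)
open import Data.List.Relation.Unary.Unique.Propositional using (Unique)
import Data.List.Relation.Unary.Unique.Propositional.Properties as Unique
open import Data.List.Relation.Unary.AllPairs using (_∷_)
open import Data.List.Membership.Propositional using (_∈_; _∉_)
open import Data.List.Membership.Propositional.Properties using (∈-filter⁻; ∈-filter⁺; ∈-++⁻)
open import Data.List.Membership.DecPropositional ℤ._≟_ using (_∈?_; _∉?_)
open import Data.List.Relation.Binary.Subset.Propositional using (_⊆_)
open import Data.List.Relation.Binary.Disjoint.Propositional using (Disjoint)
open import Data.List.Relation.Binary.Subset.Propositional.Properties using (filter-⊆; filter⁺′)
import Data.List.Relation.Binary.Sublist.Propositional as Sublist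
import Data.List.Relation.Binary.Sublist.Propositional.Properties as Sublist
open import Data.Product using (_×_; _,_; proj₁; proj₂; ∃-syntax)
open import Data.Sum using (_⊎_; inj₁; inj₂)
open import Function using (id)
open import Relation.Nullary using (yes; no; ¬?)
open import Relation.Nullary.Negation using (contradiction)
open import Relation.Unary using (Decidable; ∁)
open import Relation.Unary.Properties using (∁?)
open import Relation.Binary.Definitions using (DecidableEquality)
open import Relation.Binary.PropositionalEquality

length-filter-∁ : ∀ {A : Set} {P : A → Set} (P? : Decidable P) xs →
                  length (filter P? xs) + length (filter (∁? P?) xs) ≡ length xs
length-filter-∁ P? []       = refl
length-filter-∁ P? (x ∷ xs) with P? x
... | yes _ = cong suc (length-filter-∁ P? xs)
... | no  _ = trans (+-suc _ _) (cong suc (length-filter-∁ P? xs))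

length-filter-take-++ : ∀ {A : Set} {P : A → Set} (P? : Decidable P) k xs ys → All (∁ P) xs →
                        length (filter P? (take k (xs ++ ys))) ≤ k ∸ length xs
length-filter-take-++ P? zero    xs       ys _ = z≤n
length-filter-take-++ P? (suc k) []       ys _ =
  ≤-trans (length-filter P? (take (suc k) ys)) (≤-trans (≤-reflexive (length-take (suc k) ys)) (m⊓n≤m _ _))
length-filter-take-++ P? (suc k) (x ∷ xs) ys (¬px ∷ ¬pxs) with P? x
... | yes px = contradiction px ¬px
... | no  _  = length-filter-take-++ P? k xs ys ¬pxs

-- Deleting x from ys loses at least one element, and xs still embeds in what remains.
length-mono-⊆ : ∀ {A : Set} → DecidableEquality A → {xs ys : List A} →
                Unique xs → xs ⊆ ys → length xs ≤ length ys
length-mono-⊆ _≟_ {[]}          _                _     = z≤n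
length-mono-⊆ _≟_ {x ∷ xs} {ys} (x∉xs ∷ xs-uniq) xs⊆ys =
  ≤-trans (s≤s (length-mono-⊆ _≟_ xs-uniq xs⊆ys-x))
          (filter-notAll x≢? ys (Any.map (λ x≡y x≢y → x≢y x≡y) (xs⊆ys (here refl))))
  where
  x≢? : Decidable (x ≢_)
  x≢? y = ¬? (x ≟ y)
  xs⊆ys-x : xs ⊆ filter x≢? ys
  xs⊆ys-x y∈xs = ∈-filter⁺ x≢? (xs⊆ys (there y∈xs)) (All.lookup x∉xs y∈xs)

module Greedy (A : ℕ → List ℤ) (b : ℕ) where

  choose : List ℤ → List ℤ → List ℤ
  choose avail next = take b (filter (_∉? next) avail ++ filter (_∈? next) avail)

  free φ : ℕ → List ℤ
  free zero    = A zero
  free (suc j) = filter (_∉? φ j) (A (suc j))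
  φ j = choose (free j) (A (suc j))

  #free #freeOut #freeIn #chosenIn : ℕ → ℕ
  #free     j = length (free j)
  #freeOut  j = length (filter (_∉? A (suc j)) (free j))
  #freeIn   j = length (filter (_∈? A (suc j)) (free j))
  #chosenIn j = length (filter (_∈? A (suc j)) (φ j))

  free⊆A : ∀ j → free j ⊆ A j
  free⊆A zero    = id
  free⊆A (suc j) = filter-⊆ (_∉? φ j) (A (suc j))

  φ⊆free : ∀ j → φ j ⊆ free j
  φ⊆free j x∈φ with ∈-++⁻ (filter (_∉? A (suc j)) (free j)) (Sublist.lookup (Sublist.take-⊆ b _) x∈φ)
  ... | inj₁ x∈out = filter-⊆ (_∉? A (suc j)) (free j) x∈out
  ... | inj₂ x∈in  = filter-⊆ (_∈? A (suc j)) (free j) x∈in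

  φ-proper : ∀ j {x} → x ∈ φ j → x ∉ φ (suc j)
  φ-proper j x∈φj x∈φsj = proj₂ (∈-filter⁻ (_∉? φ j) {xs = A (suc j)} (φ⊆free (suc j) x∈φsj)) x∈φj

  #free-split : ∀ j → #freeIn j + #freeOut j ≡ #free j
  #free-split j = length-filter-∁ (_∈? A (suc j)) (free j)

  length-φ : ∀ j → b ≤ #free j → length (φ j) ≡ b
  length-φ j b≤#free = trans (length-take b _) (m≤n⇒m⊓n≡m (≤-trans b≤#free (≤-reflexive #free≡)))
    where
    #free≡ : #free j ≡ length (filter (_∉? A (suc j)) (free j) ++ filter (_∈? A (suc j)) (free j))
    #free≡ = sym (trans (length-++ (filter (_∉? A (suc j)) (free j)))
                        (trans (+-comm (#freeOut j) (#freeIn j)) (#free-split j)))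

  #chosenIn≤ : ∀ j → #chosenIn j ≤ b ∸ #freeOut j
  #chosenIn≤ j = length-filter-take-++ (_∈? A (suc j)) b _ _ (all-filter (_∉? A (suc j)) (free j))

  module _ (A-Unique : ∀ j → Unique (A j)) where

    free-Unique : ∀ j → Unique (free j)
    free-Unique zero    = A-Unique zero
    free-Unique (suc j) = Unique.filter⁺ (_∉? φ j) (A-Unique (suc j))

    φ-Unique : ∀ j → Unique (φ j)
    φ-Unique j = Unique.take⁺ b (Unique.++⁺ (Unique.filter⁺ (_∉? A (suc j)) (free-Unique j))
                                           (Unique.filter⁺ (_∈? A (suc j)) (free-Unique j))
                                           disjoint)
      where
      disjoint : Disjoint (filter (_∉? A (suc j)) (free j)) (filter (_∈? A (suc j)) (free j))
      disjoint (x∈out , x∈in) = proj₂ (∈-filter⁻ (_∉? A (suc j)) {xs = free j} x∈out)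
                                      (proj₂ (∈-filter⁻ (_∈? A (suc j)) {xs = free j} x∈in))

    #freeIn≤overlap : ∀ j → #freeIn j ≤ ∣ A j ∩ A (suc j) ∣
    #freeIn≤overlap j = length-mono-⊆ ℤ._≟_ (Unique.filter⁺ (_∈? A (suc j)) (free-Unique j))
                          (filter⁺′ (_∈? A (suc j)) (_∈? A (suc j)) id (free⊆A j))

    #freeIn≤next : ∀ j → #freeIn j ≤ length (A (suc j))
    #freeIn≤next j = length-mono-⊆ ℤ._≟_ (Unique.filter⁺ (_∈? A (suc j)) (free-Unique j))
                       (λ x∈ → proj₂ (∈-filter⁻ (_∈? A (suc j)) {xs = free j} x∈))

    next≤ : ∀ j → length (A (suc j)) ≤ #chosenIn j + #free (suc j)
    next≤ j = begin
      length (A (suc j))                                   ≡⟨ length-filter-∁ (_∈? φ j) (A (suc j)) ⟨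
      length (filter (_∈? φ j) (A (suc j))) + #free (suc j) ≤⟨ +-monoˡ-≤ (#free (suc j)) shared≤#chosenIn ⟩
      #chosenIn j + #free (suc j)                           ∎
      where
      open ≤-Reasoning
      shared≤#chosenIn : length (filter (_∈? φ j) (A (suc j))) ≤ #chosenIn j
      shared≤#chosenIn = length-mono-⊆ ℤ._≟_ (Unique.filter⁺ (_∈? φ j) (A-Unique (suc j)))
        (λ x∈ → let (x∈A , x∈φ) = ∈-filter⁻ (_∈? φ j) {xs = A (suc j)} x∈ in ∈-filter⁺ (_∈? A (suc j)) x∈φ x∈A)

+-cancel-overlap : ∀ {b c d e u t s} → b + (c + d) ≤ t + s → s ≤ e + u → e ≤ c → b + d ≤ u + t
+-cancel-overlap {b} {c} {d} {e} {u} {t} {s} b+c+d≤t+s s≤e+u e≤c = +-cancelˡ-≤ c (b + d) (u + t) (begin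
  c + (b + d)  ≡⟨ reassoc₁ c b d ⟩
  b + (c + d)  ≤⟨ b+c+d≤t+s ⟩
  t + s        ≤⟨ +-monoʳ-≤ t (≤-trans s≤e+u (+-monoˡ-≤ u e≤c)) ⟩
  t + (c + u)  ≡⟨ reassoc₂ t c u ⟩
  c + (u + t)  ∎)
  where
  open ≤-Reasoning
  reassoc₁ : ∀ c b d → c + (b + d) ≡ b + (c + d)
  reassoc₁ = solve-∀
  reassoc₂ : ∀ t c u → t + (c + u) ≡ c + (u + t)
  reassoc₂ = solve-∀

m+n≤o+p⇒m∸o≤p∸n : ∀ {m n o p} → m + n ≤ o + p → m ∸ o ≤ p ∸ n
m+n≤o+p⇒m∸o≤p∸n {m} {n} {o} {p} m+n≤o+p = begin
  m ∸ o              ≤⟨ ∸-monoˡ-≤ o (m+n≤o⇒m≤o∸n m m+n≤o+p) ⟩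
  (o + p) ∸ n ∸ o    ≡⟨ ∸-+-assoc (o + p) n o ⟩
  (o + p) ∸ (n + o)  ≡⟨ cong ((o + p) ∸_) (+-comm n o) ⟩
  (o + p) ∸ (o + n)  ≡⟨ [m+n]∸[m+o]≡n∸o o p n ⟩
  p ∸ n              ∎
  where open ≤-Reasoning

-- s j free colours at vertex j, of which e j lie in the next list and u j do not;
-- t j of the colours chosen at j lie in the next list.  The path has 2 + p edges.
module Counting (p b X c : ℕ) (s u e t : ℕ → ℕ)
  (c≤X   : c ≤ X)
  (fits  : b ⊓ c ∸ p * (X ∸ c) + b ⊓ c ≤ X)
  (s₀    : b ≤ s 0)
  (split : ∀ j → s j ≤ e j + u j)
  (e≤c   : ∀ j → j ≤ suc p → e j ≤ c)
  (e≤b   : e (suc p) ≤ b)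
  (t≤    : ∀ j → t j ≤ b ∸ u j)
  (inner : ∀ j → j ≤ p → b + X ≤ t j + s (suc j))
  (outer : b ≤ t (suc p) + s (suc (suc p)))
  where

  m d : ℕ
  m = b ⊓ c
  d = X ∸ c

  m≤X : m ≤ X
  m≤X = ≤-trans (m⊓n≤n b c) c≤X

  b≤s-next : ∀ j → j ≤ p → t j ≤ X → b ≤ s (suc j)
  b≤s-next j j≤p t≤X = +-cancelˡ-≤ X b (s (suc j)) (begin
    X + b            ≡⟨ +-comm X b ⟩
    b + X            ≤⟨ inner j j≤p ⟩
    t j + s (suc j)  ≤⟨ +-monoˡ-≤ (s (suc j)) t≤X ⟩
    X + s (suc j)    ∎)
    where open ≤-Reasoning

  t₀≤m : t 0 ≤ m
  t₀≤m = ⊓-glb (≤-trans (t≤ 0) (m∸n≤m b (u 0)))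
               (≤-trans (t≤ 0) (≤-trans (m≤n+o⇒m∸n≤o b (u 0) b≤u₀+e₀) (e≤c 0 z≤n)))
    where
    b≤u₀+e₀ : b ≤ u 0 + e 0
    b≤u₀+e₀ = ≤-trans s₀ (≤-trans (split 0) (≤-reflexive (+-comm (e 0) (u 0))))

  t-step : ∀ j → j ≤ p → t (suc j) ≤ t j ∸ d
  t-step j j≤p = ≤-trans (t≤ (suc j)) (m+n≤o+p⇒m∸o≤p∸n {b} {d} {u (suc j)} {t j}
    (+-cancel-overlap {b} {c} {d} {e (suc j)} (≤-trans (≤-reflexive (cong (λ z → b + z) (m+[n∸m]≡n c≤X))) (inner j j≤p))
                      (split (suc j)) (e≤c (suc j) (s≤s j≤p))))

  forced : ∀ j → j ≤ p → b ≤ s j × t j ≤ m ∸ j * d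
  forced zero    _    = s₀ , t₀≤m
  forced (suc j) sj≤p = b≤s-next j j≤p (≤-trans tj≤ (≤-trans (m∸n≤m m (j * d)) m≤X)) , (begin
    t (suc j)        ≤⟨ t-step j j≤p ⟩
    t j ∸ d          ≤⟨ ∸-monoˡ-≤ d tj≤ ⟩
    m ∸ j * d ∸ d    ≡⟨ ∸-+-assoc m (j * d) d ⟩
    m ∸ (j * d + d)  ≡⟨ cong (m ∸_) (+-comm (j * d) d) ⟩
    m ∸ suc j * d    ∎)
    where
    open ≤-Reasoning
    j≤p : j ≤ p
    j≤p = ≤-trans (n≤1+n j) sj≤p
    tj≤ : t j ≤ m ∸ j * d
    tj≤ = proj₂ (forced j j≤p)

  tₚ+m≤X : t p + m ≤ X
  tₚ+m≤X = ≤-trans (+-monoˡ-≤ m (proj₂ (forced p ≤-refl))) fits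

  b≤s-penultimate : b ≤ s (suc p)
  b≤s-penultimate = b≤s-next p ≤-refl (≤-trans (m≤m+n (t p) m) tₚ+m≤X)

  b≤u-penultimate : b ≤ u (suc p)
  b≤u-penultimate = +-cancelˡ-≤ X b (u (suc p)) (begin
    X + b                            ≡⟨ +-comm X b ⟩
    b + X                            ≤⟨ inner p ≤-refl ⟩
    t p + s (suc p)                  ≤⟨ +-monoʳ-≤ (t p) (split (suc p)) ⟩
    t p + (e (suc p) + u (suc p))    ≤⟨ +-monoʳ-≤ (t p) (+-monoˡ-≤ (u (suc p)) (⊓-glb e≤b (e≤c (suc p) ≤-refl))) ⟩
    t p + (m + u (suc p))            ≡⟨ +-assoc (t p) m (u (suc p)) ⟨
    t p + m + u (suc p)              ≤⟨ +-monoˡ-≤ (u (suc p)) tₚ+m≤X ⟩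
    X + u (suc p)                    ∎)
    where open ≤-Reasoning

  b≤s-last : b ≤ s (suc (suc p))
  b≤s-last = subst (λ z → b ≤ z + s (suc (suc p))) t≡0 outer
    where
    t≡0 : t (suc p) ≡ 0
    t≡0 = n≤0⇒n≡0 (≤-trans (t≤ (suc p)) (≤-reflexive (m≤n⇒m∸n≡0 b≤u-penultimate)))

  b≤s : ∀ j → j ≤ suc (suc p) → b ≤ s j
  b≤s j j≤ with m≤n⇒m<n∨m≡n j≤
  ... | inj₂ refl = b≤s-last
  ... | inj₁ (s≤s j≤′) with m≤n⇒m<n∨m≡n j≤′
  ...   | inj₂ refl          = b≤s-penultimate
  ...   | inj₁ (s≤s j≤p)     = proj₁ (forced j j≤p)

m∸n+m≤o : ∀ {m n o} → m + m ≤ n + o → m ≤ o → m ∸ n + m ≤ o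
m∸n+m≤o {m} {n} {o} m+m≤n+o m≤o with ≤-total n m
... | inj₁ n≤m = ≤-trans (≤-reflexive (sym (+-∸-comm m n≤m))) (m≤n+o⇒m∸n≤o (m + m) n m+m≤n+o)
... | inj₂ m≤n = subst (λ z → z + m ≤ o) (sym (m≤n⇒m∸n≡0 m≤n)) m≤o

budget⇒fits : ∀ p {m X c} → c ≤ X → m ≤ X → m + m + p * c ≤ suc p * X → m ∸ p * (X ∸ c) + m ≤ X
budget⇒fits p {m} {X} {c} c≤X m≤X budget = m∸n+m≤o (+-cancelʳ-≤ (p * c) (m + m) (p * (X ∸ c) + X) (begin
  m + m + p * c                  ≤⟨ budget ⟩
  X + p * X                      ≡⟨ cong (λ z → X + p * z) (m∸n+n≡m c≤X) ⟨
  X + p * (X ∸ c + c)            ≡⟨ regroup X p (X ∸ c) c ⟩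
  p * (X ∸ c) + X + p * c        ∎)) m≤X
  where
  open ≤-Reasoning
  regroup : ∀ X p d c → X + p * (d + c) ≡ p * d + X + p * c
  regroup = solve-∀

case₁⇒c≤X : ∀ p {c X} → c * (2 + p) ≤ suc p * X → c ≤ X
case₁⇒c≤X p {c} {X} c[2+p]≤[1+p]X = *-cancelʳ-≤ c X (2 + p) (begin
  c * (2 + p)  ≤⟨ c[2+p]≤[1+p]X ⟩
  suc p * X    ≤⟨ *-monoˡ-≤ X (n≤1+n (suc p)) ⟩
  (2 + p) * X  ≡⟨ *-comm (2 + p) X ⟩
  X * (2 + p)  ∎)
  where open ≤-Reasoning

case₁⇒budget : ∀ p {m c X} → m ≤ c → c * (2 + p) ≤ suc p * X → m + m + p * c ≤ suc p * X
case₁⇒budget p {m} {c} m≤c c[2+p]≤[1+p]X =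
  ≤-trans (+-monoˡ-≤ (p * c) (+-mono-≤ m≤c m≤c)) (≤-trans (≤-reflexive (regroup c p)) c[2+p]≤[1+p]X)
  where
  regroup : ∀ c p → c + c + p * c ≡ c * (2 + p)
  regroup = solve-∀

case₂⇒budget : ∀ p {m b c X} → m ≤ b → c * p + 2 * b ≤ suc p * X → m + m + p * c ≤ suc p * X
case₂⇒budget p {m} {b} {c} m≤b cp+2b≤[1+p]X =
  ≤-trans (+-monoˡ-≤ (p * c) (+-mono-≤ m≤b m≤b)) (≤-trans (≤-reflexive (regroup b c p)) cp+2b≤[1+p]X)
  where
  regroup : ∀ b c p → b + b + p * c ≡ c * p + 2 * b
  regroup = solve-∀

-- If X < c the hypothesis forces 2b ≤ X, i.e. a ≥ 3b, which violates a < 2(n+1)b/n.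
case₂⇒c≤X : ∀ p {b c X} → c * p + 2 * b ≤ suc p * X → (b + X) * (2 + p) < 2 * (2 + p + 1) * b → c ≤ X
case₂⇒c≤X p {b} {c} {X} cp+2b≤[1+p]X a<bound = ≮⇒≥ (λ X<c → <⇒≱ a<bound (begin
  2 * (2 + p + 1) * b          ≤⟨ m≤m+n _ (b * p) ⟩
  2 * (2 + p + 1) * b + b * p  ≡⟨ regroup b p ⟩
  (b + 2 * b) * (2 + p)        ≤⟨ *-monoˡ-≤ (2 + p) (+-monoʳ-≤ b (X<c⇒2b≤X X<c)) ⟩
  (b + X) * (2 + p)            ∎))
  where
  open ≤-Reasoning
  regroup : ∀ b p → 2 * (2 + p + 1) * b + b * p ≡ (b + 2 * b) * (2 + p)
  regroup = solve-∀
  regroup′ : ∀ X p b → suc X * p + 2 * b ≡ X * p + (p + 2 * b)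
  regroup′ = solve-∀
  X<c⇒2b≤X : X < c → 2 * b ≤ X
  X<c⇒2b≤X X<c = m+n≤o⇒n≤o p (+-cancelˡ-≤ (X * p) (p + 2 * b) X (begin
    X * p + (p + 2 * b)  ≡⟨ regroup′ X p b ⟨
    suc X * p + 2 * b    ≤⟨ +-monoˡ-≤ (2 * b) (*-monoˡ-≤ p X<c) ⟩
    c * p + 2 * b        ≤⟨ cp+2b≤[1+p]X ⟩
    X + p * X            ≡⟨ cong (λ z → X + z) (*-comm p X) ⟩
    X + X * p            ≡⟨ +-comm X (X * p) ⟩
    X * p + X            ∎))

toℚᵘ-frac : ∀ p d → toℚᵘ (frac p (suc d)) ℚᵘ.≃ mkℚᵘ p d
toℚᵘ-frac p d = toℚᵘ-fromℚᵘ (mkℚᵘ p d)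

toℚᵘ-frac-*-⟦⟧ : ∀ p d z → toℚᵘ (frac p (suc d) ℚ.* ⟦ z ⟧) ℚᵘ.≃ mkℚᵘ (p ℤ.* z) d
toℚᵘ-frac-*-⟦⟧ p d z = begin
  toℚᵘ (frac p (suc d) ℚ.* ⟦ z ⟧)          ≈⟨ toℚᵘ-homo-* (frac p (suc d)) ⟦ z ⟧ ⟩
  toℚᵘ (frac p (suc d)) ℚᵘ.* toℚᵘ ⟦ z ⟧     ≈⟨ ℚᵘP.*-cong (toℚᵘ-frac p d) (toℚᵘ-frac z 0) ⟩
  mkℚᵘ p d ℚᵘ.* mkℚᵘ z 0                    ≈⟨ *≡* (cong (λ k → p ℤ.* z ℤ.* + suc k) (sym (*-identityʳ d))) ⟩
  mkℚᵘ (p ℤ.* z) d                          ∎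
  where open ℚᵘP.≃-Reasoning

toℚᵘ-frac-*-⟦⟧-minus : ∀ p r d x y →
  toℚᵘ (frac p (suc d) ℚ.* ⟦ x ⟧ ℚ.- frac r (suc d) ℚ.* ⟦ y ⟧) ℚᵘ.≃ mkℚᵘ (p ℤ.* x ℤ.- r ℤ.* y) d
toℚᵘ-frac-*-⟦⟧-minus p r d x y = begin
  toℚᵘ (P ℚ.- R)                          ≈⟨ toℚᵘ-homo-+ P (ℚ.- R) ⟩
  toℚᵘ P ℚᵘ.+ toℚᵘ (ℚ.- R)                ≈⟨ ℚᵘP.+-cong (toℚᵘ-frac-*-⟦⟧ p d x)
                                               (ℚᵘP.≃-trans (toℚᵘ-homo‿- R) (ℚᵘP.-‿cong (toℚᵘ-frac-*-⟦⟧ r d y))) ⟩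
  mkℚᵘ (p ℤ.* x) d ℚᵘ.- mkℚᵘ (r ℤ.* y) d  ≈⟨ *≡* (trans (common-denominator (p ℤ.* x) (r ℤ.* y) (+ suc d))
                                                        (cong (λ D → (p ℤ.* x ℤ.- r ℤ.* y) ℤ.* D)
                                                              (sym (ℤP.pos-* (suc d) (suc d))))) ⟩
  mkℚᵘ (p ℤ.* x ℤ.- r ℤ.* y) d            ∎
  where
  open ℚᵘP.≃-Reasoning
  P R : ℚ
  P = frac p (suc d) ℚ.* ⟦ x ⟧
  R = frac r (suc d) ℚ.* ⟦ y ⟧
  common-denominator : ∀ u v D → (u ℤ.* D ℤ.+ ℤ.- v ℤ.* D) ℤ.* D ≡ (u ℤ.- v) ℤ.* (D ℤ.* D)
  common-denominator = ℤRing.solve-∀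

≤-floor⇒≤ᵘ : ∀ {c} q → c ℤ.≤ floor q → mkℚᵘ c 0 ℚᵘ.≤ toℚᵘ q
≤-floor⇒≤ᵘ (mkℚ num d _) c≤⌊q⌋ = *≤* (ℤP.≤-trans (ℤP.*-monoʳ-≤-nonNeg (+ suc d) c≤⌊q⌋)
  (ℤP.≤-trans ([n/d]*d≤n num (+ suc d)) (ℤP.≤-reflexive (sym (ℤP.*-identityʳ num)))))

≤-floor⇒*≤ : ∀ {c w d} q → toℚᵘ q ℚᵘ.≃ mkℚᵘ w d → c ℤ.≤ floor q → c ℤ.* + suc d ℤ.≤ w
≤-floor⇒*≤ {c} {w} {d} q q≃w/d c≤⌊q⌋ =
  subst (c ℤ.* + suc d ℤ.≤_) (ℤP.*-identityʳ w) (ℚᵘP.drop-*≤* (ℚᵘP.≤-respʳ-≃ q≃w/d (≤-floor⇒≤ᵘ q c≤⌊q⌋)))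

⟦⟧<⇒*< : ∀ {a w d} q → toℚᵘ q ℚᵘ.≃ mkℚᵘ w d → ⟦ a ⟧ ℚ.< q → a ℤ.* + suc d ℤ.< w
⟦⟧<⇒*< {a} {w} {d} q q≃w/d a<q = subst (a ℤ.* + suc d ℤ.<_) (ℤP.*-identityʳ w)
  (ℚᵘP.drop-*<* (ℚᵘP.<-respʳ-≃ q≃w/d (ℚᵘP.<-respˡ-≃ (toℚᵘ-frac a 0) (toℚᵘ-mono-< a<q))))

≤-minus⇒+≤ : ∀ {i j k} → i ℤ.≤ j ℤ.- k → i ℤ.+ k ℤ.≤ j
≤-minus⇒+≤ {i} {j} {k} i≤j-k = subst (i ℤ.+ k ℤ.≤_) (cancel j k) (ℤP.+-monoˡ-≤ k i≤j-k)
  where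
  cancel : ∀ j k → j ℤ.- k ℤ.+ k ≡ j
  cancel = ℤRing.solve-∀

-- n is spelled suc (suc (suc k)) as in lemma1: with 3 + k, unification would start
-- normalising rational arithmetic on open terms.
≤-floor-cfun : ∀ k a b c → let n = suc (suc (suc k)) in
  ⟦ a ⟧ ℚ.< frac (+ (2 * (n + 1))) n ℚ.* ⟦ b ⟧ → c ℤ.≤ floor (cfun n a b) →
  c ℤ.* + (3 + k) ℤ.≤ + (2 + k) ℤ.* (a ℤ.- b) ⊎ c ℤ.* + suc k ℤ.+ + 2 ℤ.* b ℤ.≤ + (2 + k) ℤ.* (a ℤ.- b)
≤-floor-cfun k a b c a<bound c≤⌊cfun⌋
  with ⟦ a ⟧ ℚP.<? frac (+ (2 * suc (suc (suc k)) ∸ 1)) (suc (suc k)) ℚ.* ⟦ b ⟧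
... | yes _ = inj₁ (≤-floor⇒*≤ _ (toℚᵘ-frac-*-⟦⟧ (+ (2 + k)) (2 + k) (a ℤ.- b)) c≤⌊cfun⌋)
... | no _ with ⟦ a ⟧ ℚP.<? frac (+ (2 * (suc (suc (suc k)) + 1))) (suc (suc (suc k))) ℚ.* ⟦ b ⟧
...   | yes _ = inj₂ (≤-minus⇒+≤ (≤-floor⇒*≤ _ (toℚᵘ-frac-*-⟦⟧-minus (+ (2 + k)) (+ 2) k (a ℤ.- b) b) c≤⌊cfun⌋))
...   | no a≮bound = contradiction a<bound a≮bound

+*+≡+* : ∀ m n → + m ℤ.* + n ≡ + (m * n)
+*+≡+* m n = sym (ℤP.pos-* m n)

+*[+-+]≡+* : ∀ k b X → + k ℤ.* (+ (b + X) ℤ.- + b) ≡ + (k * X)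
+*[+-+]≡+* k b X = trans (cong (λ z → + k ℤ.* z) b+X-b≡X) (+*+≡+* k X)
  where
  cancel : ∀ x y → x ℤ.+ y ℤ.- x ≡ y
  cancel = ℤRing.solve-∀
  b+X-b≡X : + (b + X) ℤ.- + b ≡ + X
  b+X-b≡X = trans (cong (λ z → z ℤ.- + b) (ℤP.pos-+ b X)) (cancel (+ b) (+ X))

admissible : ∀ k b X c → let n = suc (suc (suc k)) in
  ⟦ + (b + X) ⟧ ℚ.< frac (+ (2 * (n + 1))) n ℚ.* ⟦ + b ⟧ →
  + c ℤ.≤ floor (cfun n (+ (b + X)) (+ b)) →
  c ≤ X × b ⊓ c ∸ suc k * (X ∸ c) + b ⊓ c ≤ X
admissible k b X c a<bound c≤⌊cfun⌋ =
  c≤X , budget⇒fits (suc k) {X = X} c≤X (≤-trans (m⊓n≤n b c) c≤X) (proj₂ c≤X×budget)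
  where
  c≤X×budget : c ≤ X × b ⊓ c + b ⊓ c + suc k * c ≤ (2 + k) * X
  c≤X : c ≤ X
  c≤X = proj₁ c≤X×budget
  c≤X×budget with ≤-floor-cfun k (+ (b + X)) (+ b) (+ c) a<bound c≤⌊cfun⌋
  ... | inj₁ case₁ = case₁⇒c≤X (suc k) {X = X} c[3+k]≤[2+k]X
                   , case₁⇒budget (suc k) {X = X} (m⊓n≤n b c) c[3+k]≤[2+k]X
    where
    c[3+k]≤[2+k]X : c * (3 + k) ≤ (2 + k) * X
    c[3+k]≤[2+k]X = ℤP.drop‿+≤+ (subst₂ ℤ._≤_ (+*+≡+* c (3 + k)) (+*[+-+]≡+* (2 + k) b X) case₁)
  ... | inj₂ case₂ = case₂⇒c≤X (suc k) {b} {X = X} c[1+k]+2b≤[2+k]X a<bound′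
                   , case₂⇒budget (suc k) {X = X} (m⊓n≤m b c) c[1+k]+2b≤[2+k]X
    where
    c[1+k]+2b≤[2+k]X : c * suc k + 2 * b ≤ (2 + k) * X
    c[1+k]+2b≤[2+k]X = ℤP.drop‿+≤+ (subst₂ ℤ._≤_
      (trans (cong₂ ℤ._+_ (+*+≡+* c (suc k)) (+*+≡+* 2 b)) (sym (ℤP.pos-+ (c * suc k) (2 * b))))
      (+*[+-+]≡+* (2 + k) b X) case₂)
    a<bound′ : (b + X) * (3 + k) < 2 * (3 + k + 1) * b
    a<bound′ = ℤP.drop‿+<+ (subst₂ ℤ._<_ (+*+≡+* (b + X) (3 + k)) (+*+≡+* (2 * (3 + k + 1)) b)
      (⟦⟧<⇒*< {a = + (b + X)} _ (toℚᵘ-frac-*-⟦⟧ (+ (2 * (3 + k + 1))) (2 + k) (+ b)) a<bound))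

nonNegative-view : ∀ {m i} → + m ℤ.≤ i → ∃[ c ] i ≡ + c
nonNegative-view (+≤+ _) = _ , refl

clamp : (n j : ℕ) → Fin (suc n)
clamp n       zero    = zero
clamp zero    (suc j) = zero
clamp (suc n) (suc j) = suc (clamp n j)

clamp-toℕ : ∀ n (v : Fin (suc n)) → clamp n (toℕ v) ≡ v
clamp-toℕ n       zero    = refl
clamp-toℕ (suc n) (suc v) = cong suc (clamp-toℕ n v)

clamp-fromℕ : ∀ n → clamp n n ≡ fromℕ n
clamp-fromℕ zero    = refl
clamp-fromℕ (suc n) = cong suc (clamp-fromℕ n)

clamp-<-≢-fromℕ : ∀ {n j} → j < n → clamp n j ≢ fromℕ n
clamp-<-≢-fromℕ {suc n} {zero}  _         ()
clamp-<-≢-fromℕ {suc n} {suc j} (s≤s j<n) eq = clamp-<-≢-fromℕ j<n (Fin.suc-injective eq)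

clamp-inject₁ : ∀ {n j} (j<n : j < n) → clamp n j ≡ inject₁ (fromℕ< j<n)
clamp-inject₁ {suc n} {zero}  _         = refl
clamp-inject₁ {suc n} {suc j} (s≤s j<n) = cong suc (clamp-inject₁ j<n)

clamp-suc : ∀ {n j} (j<n : j < n) → clamp n (suc j) ≡ suc (fromℕ< j<n)
clamp-suc {suc n} {zero}  _         = refl
clamp-suc {suc n} {suc j} (s≤s j<n) = cong suc (clamp-suc j<n)

path-colourable : ∀ p b X c (L : ListAssignment (2 + p)) →
  c ≤ X → b ⊓ c ∸ p * (X ∸ c) + b ⊓ c ≤ X →
  (∀ v → Unique (L v)) →
  length (L zero) ≡ b → length (L (fromℕ (2 + p))) ≡ b →
  (∀ v → v ≢ zero → v ≢ fromℕ (2 + p) → length (L v) ≡ b + X) →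
  (∀ i → ∣ L (inject₁ i) ∩ L (suc i) ∣ ≤ c) →
  Coloring (2 + p) L (+ b)
path-colourable p b X c L c≤X fits L-Unique |L₀| |Lₙ| |Lᵥ| shared = record
  { φ        = λ v → φ (toℕ v)
  ; φ-set    = λ v → φ-Unique A-Unique (toℕ v)
  ; φ-size   = λ v → cong +_ (length-φ (toℕ v) (b≤#free (toℕ v) (toℕ≤pred[n] v)))
  ; φ-sub    = λ v x x∈ → subst (λ w → x ∈ L w) (clamp-toℕ (2 + p) v) (free⊆A (toℕ v) (φ⊆free (toℕ v) x∈))
  ; φ-proper = λ i x x∈ → φ-proper (toℕ i) (subst (λ j → x ∈ φ j) (toℕ-inject₁ i) x∈)
  }
  where
  -- the greedy colouring runs along ℕ, repeating the last list beyond the end of the path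
  A : ℕ → List ℤ
  A j = L (clamp (2 + p) j)

  open Greedy A b

  A-Unique : ∀ j → Unique (A j)
  A-Unique j = L-Unique (clamp (2 + p) j)

  |Aₙ| : length (A (2 + p)) ≡ b
  |Aₙ| = trans (cong (λ v → length (L v)) (clamp-fromℕ (2 + p))) |Lₙ|

  |A-inner| : ∀ j → j ≤ p → length (A (suc j)) ≡ b + X
  |A-inner| j j≤p = |Lᵥ| (clamp (2 + p) (suc j)) (λ ()) (clamp-<-≢-fromℕ (s≤s (s≤s j≤p)))

  #freeIn≤c : ∀ j → j ≤ suc p → #freeIn j ≤ c
  #freeIn≤c j j≤ = ≤-trans (#freeIn≤overlap A-Unique j)
    (subst₂ (λ v w → ∣ L v ∩ L w ∣ ≤ c) (sym (clamp-inject₁ (s≤s j≤))) (sym (clamp-suc (s≤s j≤)))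
            (shared (fromℕ< (s≤s j≤))))

  b≤#free : ∀ j → j ≤ 2 + p → b ≤ #free j
  b≤#free = Counting.b≤s p b X c #free #freeOut #freeIn #chosenIn c≤X fits
    (≤-reflexive (sym |L₀|))
    (λ j → ≤-reflexive (sym (#free-split j)))
    #freeIn≤c
    (≤-trans (#freeIn≤next A-Unique (suc p)) (≤-reflexive |Aₙ|))
    #chosenIn≤
    (λ j j≤p → ≤-trans (≤-reflexive (sym (|A-inner| j j≤p))) (next≤ A-Unique j))
    (≤-trans (≤-reflexive (sym |Aₙ|)) (next≤ A-Unique (suc p)))

path-colourable-cfun : ∀ k {b X a} → b + X ≡ a → let n = suc (suc (suc k)) in
  ⟦ + a ⟧ ℚ.< frac (+ (2 * (n + 1))) n ℚ.* ⟦ + b ⟧ →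
  (L : ListAssignment n) → (∀ v → Unique (L v)) →
  length (L zero) ≡ b → + length (L (fromℕ n)) ≡ + b →
  (∀ v → v ≢ zero → v ≢ fromℕ n → + length (L v) ≡ + a) →
  (∀ (i : Fin n) → + ∣ L (inject₁ i) ∩ L (suc i) ∣ ℤ.≤ floor (cfun n (+ a) (+ b))) →
  Coloring n L (+ b)
path-colourable-cfun k {b} {X} refl a<bound L L-Unique |L₀| |Lₙ| |Lᵥ| shared =
  path-colourable (suc k) b X c L (proj₁ c≤X×fits) (proj₂ c≤X×fits) L-Unique |L₀| (ℤP.+-injective |Lₙ|)
    (λ v v≢0 v≢n → ℤP.+-injective (|Lᵥ| v v≢0 v≢n))
    (λ i → ℤP.drop‿+≤+ (subst (λ z → + ∣ L (inject₁ i) ∩ L (suc i) ∣ ℤ.≤ z) ⌊cfun⌋≡c (shared i)))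
  where
  ⌊cfun⌋ : ℤ
  ⌊cfun⌋ = floor (cfun (suc (suc (suc k))) (+ (b + X)) (+ b))
  ∃c : ∃[ c ] ⌊cfun⌋ ≡ + c
  ∃c = nonNegative-view (shared zero)
  c : ℕ
  c = proj₁ ∃c
  ⌊cfun⌋≡c : ⌊cfun⌋ ≡ + c
  ⌊cfun⌋≡c = proj₂ ∃c
  c≤X×fits : c ≤ X × b ⊓ c ∸ suc k * (X ∸ c) + b ⊓ c ≤ X
  c≤X×fits = admissible k b X c a<bound (ℤP.≤-reflexive (sym ⌊cfun⌋≡c))

lemma1 : (n : ℕ) (a b : ℤ) → 3 ℕ.≤ n → b ℤ.≤ a
    → ⟦ a ⟧ ℚ.< frac (+ (2 ℕ.* (n ℕ.+ 1))) n ℚ.* ⟦ b ⟧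
    → (L : ListAssignment n)
    → (∀ v → Unique (L v))
    → + length (L zero) ≡ b
    → + length (L (fromℕ n)) ≡ b
    → (∀ v → v ≢ zero → v ≢ fromℕ n → + length (L v) ≡ a)
    → (∀ (i : Fin n) → + ∣ L (inject₁ i) ∩ L (suc i) ∣ ℤ.≤ floor (cfun n a b))
    → Coloring n L b
lemma1 (suc (suc (suc k))) -[1+ _ ] _ _ () _ _ _ refl _ _ _
lemma1 (suc (suc (suc k))) (+ a) _ (s≤s (s≤s (s≤s _))) (+≤+ b≤a) a<bound L L-Unique refl =
  path-colourable-cfun k (proj₂ (m≤n⇒∃[o]m+o≡n b≤a)) a<bound L L-Unique refl
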